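{- Let $n\ge 2$ and let $\Pi'_n$ be the output of the greedy algorithm described in the context. Then $\Pi'_n$ is a universal word (u-word) for $n$-permutations: every permutation of $\{1,\dots,n\}$ is the reduced form of exactly one factor of length $n$ of $\Pi'_n$.
   Context: For a word $w$ of distinct integers, $\mathrm{red}(w)$ denotes the word obtained by replacing the $i$-th smallest entry of $w$ by $i$. A factor of a word is a block of consecutive letters (factors at different positions are counted separately). Extensions: for a word $\pi=\pi_1\cdots\pi_m$ of distinct integers and $1\le i\le m$, the $i$-th extension of $\pi$ is $c_b(\pi_1)\cdots c_b(\pi_m)\,b$, where $b$ is the $i$-th smallest element of $\{\pi_1,\dots,\pi_m\}$ and $c_b(x)=x$ if $x<b$, $c_b(x)=x+1$ if $x\ge b$. The $(m+1)$-st extension of $\pi$ is $\pi b$ with $b=\max_j\pi_j+1$. Greedy algorithm: start with $\Pi'_{n,0}=12\cdots(n-1)$. Given $\Pi'_{n,k}=a_1a_2\cdots a_{k+n-1}$ (a permutation of $\{1,\dots,k+n-1\}$ in which no two factors of length $n$ have the same reduced form), let $i\in\{1,\dots,n\}$ be minimal such that the $i$-th extension of $a_{k+1}\cdots a_{k+n-1}$ has reduced form different from the reduced form of every length-$n$ factor of $\Pi'_{n,k}$, let $b$ be the last element of this extension, and set $\Pi'_{n,k+1}=c_b(a_1)\cdots c_b(a_{k+n-1})\,b$. If no such $i$ exists, the algorithm terminates and outputs $\Pi'_n:=\Pi'_{n,k}$. -}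

module Defs where

open import Data.Nat using (ℕ; zero; suc; _∸_; _<ᵇ_; _≡ᵇ_; _⊔_)
open import Data.Nat.Properties using (_≟_)
open import Data.Bool using (Bool; true; false; if_then_else_; _∧_; not)
open import Data.List using (List; []; _∷_; _++_; [_]; map; length; filterᵇ; filter; take; drop; applyUpTo; upTo; foldr)
open import Data.Bool.ListAction using (any)
open import Data.List.Properties using (≡-dec)
open import Data.Maybe using (Maybe; just; nothing)
open import Data.Product using (_×_; ∃)
open import Relation.Nullary.Decidable using (⌊_⌋)
open import Relation.Binary.PropositionalEquality using (_≡_)
open import Data.List.Relation.Binary.Permutation.Propositional using (_↭_)

-- Words are lists of natural numbers (entries assumed distinct where relevant).

countLess : ℕ → List ℕ → ℕ
countLess x w = length (filterᵇ (λ y → y <ᵇ x) w)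

red : List ℕ → List ℕ
red w = map (λ x → suc (countLess x w)) w

factors : ℕ → List ℕ → List (List ℕ)
factors n w = applyUpTo (λ i → take n (drop i w)) (suc (length w) ∸ n)

c : ℕ → ℕ → ℕ
c b x = if x <ᵇ b then x else suc x

findᵇ : {A : Set} → (A → Bool) → List A → Maybe A
findᵇ p [] = nothing
findᵇ p (x ∷ xs) = if p x then just x else findᵇ p xs

-- the i-th smallest element (1-based) of a word of distinct entries
ithSmallest : ℕ → List ℕ → Maybe ℕ
ithSmallest i π = findᵇ (λ x → countLess x π ≡ᵇ (i ∸ 1)) π

maxList : List ℕ → ℕ
maxList = foldr _⊔_ 0

-- the i-th extension of π (1 ≤ i ≤ m+1, m = |π|); nothing for other i
extension : ℕ → List ℕ → Maybe (List ℕ)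
extension zero π = nothing
extension (suc j) π with suc j ≡ᵇ suc (length π)
... | true  = just (π ++ [ suc (maxList π) ])
... | false with ithSmallest (suc j) π
...   | nothing = nothing
...   | just b  = just (map (c b) π ++ [ b ])

lastOr0 : List ℕ → ℕ
lastOr0 [] = 0
lastOr0 (x ∷ []) = x
lastOr0 (x ∷ y ∷ ys) = lastOr0 (y ∷ ys)

eqList : List ℕ → List ℕ → Bool
eqList u v = ⌊ ≡-dec _≟_ u v ⌋

newExt : ℕ → List ℕ → List ℕ → ℕ → Bool
newExt n w π i with extension i π
... | nothing = false
... | just e  = not (any (λ f → eqList (red f) (red e)) (factors n w))

-- one step of the greedy algorithm: w = Π'_{n,k}; the last n-1 letters are π.
-- Returns nothing if no extension index i ∈ {1..n} works (termination).
step : ℕ → List ℕ → Maybe (List ℕ)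
step n w with findᵇ (newExt n w π) (applyUpTo suc n)
  where π = drop (length w ∸ (n ∸ 1)) w
... | nothing = nothing
... | just i with extension i (drop (length w ∸ (n ∸ 1)) w)
...   | nothing = nothing
...   | just e  = just (map (c (lastOr0 e)) w ++ [ lastOr0 e ])

Pi' : ℕ → ℕ → Maybe (List ℕ)
Pi' n zero = just (map suc (upTo (n ∸ 1)))
Pi' n (suc k) with Pi' n k
... | nothing = nothing
... | just w  = step n w

occurrences : ℕ → List ℕ → List ℕ → ℕ
occurrences n w p = length (filter (λ f → ≡-dec _≟_ (red f) p) (factors n w))

UWord : ℕ → List ℕ → Set
UWord n w = (p : List ℕ) → p ↭ map suc (upTo n) → occurrences n w p ≡ 1

-- Write n = m + 1.  Length-m patterns are the vertices and length-n patterns the edges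
-- of a graph in which every vertex has m + 1 outgoing edges (append a last letter of
-- rank i) and m + 1 incoming ones (prepend a first letter of rank k).  The n-factors of
-- Π'_{n,k} are distinct patterns forming a trail from the identity pattern to the
-- pattern of the last n - 1 letters, and choosing the least new extension ensures that
-- when an edge out of v with last rank i is used, so are those with smaller last rank;
-- hence a vertex has all its out-edges used as soon as its top-rank out-edge is used.
-- When the algorithm stops, all out-edges of the final vertex are used; since in-degrees
-- are at most m + 1, counting ends of edges shows that the trail is closed, and then
-- every vertex with all out-edges used has all in-edges used.  The top-rank out-edge of
-- red(a γ) is an in-edge of red(γ B) for B above all letters, so induction on the number
-- of letters in front of an increasing tail, starting at the identity (the final vertex),
-- shows that all edges are used: every n-pattern occurs, and exactly once.

module Submission where

open import Defs
open import Data.Nat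
open import Data.Nat.Properties
open import Data.Bool using (Bool; true; false; if_then_else_; not; T)
open import Data.Bool.Properties using (T?; not-injective)
open import Data.List hiding (findᵇ; any)
open import Data.List.Properties
open import Data.List.Membership.Propositional using (_∈_; _∉_)
open import Data.List.Membership.Propositional.Properties
open import Data.List.Membership.DecPropositional _≟_ using (_∈?_)
open import Data.List.Relation.Unary.Any using (here; there)
open import Data.List.Relation.Unary.All as All using (All; []; _∷_)
import Data.List.Relation.Unary.All.Properties as All
open import Data.List.Relation.Unary.AllPairs using (AllPairs; []; _∷_)
import Data.List.Relation.Unary.AllPairs.Properties as AllPairs
open import Data.List.Relation.Unary.Unique.Propositional using (Unique)
import Data.List.Relation.Unary.Unique.Propositional.Properties as Unique
open import Data.List.Relation.Binary.Permutation.Propositional using (_↭_; ↭-sym; ↭⇒↭ₛ)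
open import Data.List.Relation.Binary.Permutation.Propositional.Properties using (filter-↭; ↭-length; ∈-resp-↭)
import Data.List.Relation.Binary.Permutation.Setoid.Properties as Permutationₛ
open import Data.Product using (Σ; ∃; _×_; _,_; proj₁)
open import Data.Sum using (_⊎_; inj₁; inj₂)
open import Data.Maybe using (just; nothing)
open import Data.Bool.ListAction using (any)
open import Data.Empty using (⊥-elim)
open import Relation.Nullary using (Dec; yes; no)
open import Relation.Binary.Definitions using (tri<; tri≈; tri>)
open import Relation.Binary.PropositionalEquality hiding ([_])
open import Function using (_∘_)

Unique-∷ʳ⁺ : ∀ {A : Set} {u : List A} {x} → Unique u → x ∉ u → Unique (u ++ [ x ])
Unique-∷ʳ⁺ u! x∉u = Unique.++⁺ u! ([] ∷ []) λ { (a∈u , here refl) → x∉u a∈u }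

Unique-∷ʳ⁻ : ∀ {A : Set} (u : List A) {x} → Unique (u ++ [ x ]) → Unique u × x ∉ u
Unique-∷ʳ⁻ []      _          = [] , λ ()
Unique-∷ʳ⁻ (a ∷ u) (a∉ ∷ ux!) with Unique-∷ʳ⁻ u ux!
... | u! , x∉u = All.++⁻ˡ u a∉ ∷ u! , λ
  { (here refl) → All.lookup a∉ (∈-++⁺ʳ u (here refl)) refl
  ; (there x∈u) → x∉u x∈u }

Unique-map⁺-local : ∀ {A B : Set} (f : A → B) {xs} → Unique xs →
  (∀ {a b} → a ∈ xs → b ∈ xs → f a ≡ f b → a ≡ b) → Unique (map f xs)
Unique-map⁺-local f {[]} [] inj = []
Unique-map⁺-local f {x ∷ xs} (x∉ ∷ xs!) inj =
  All.map⁺ (All.tabulate λ b∈ e → All.lookup x∉ b∈ (inj (here refl) (there b∈) e))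
  ∷ Unique-map⁺-local f xs! (λ a∈ b∈ → inj (there a∈) (there b∈))

Unique-resp-↭ : ∀ {A : Set} {u v : List A} → u ↭ v → Unique u → Unique v
Unique-resp-↭ {A} p = Permutationₛ.Unique-resp-↭ (setoid A) (↭⇒↭ₛ p)

∈-++-∷⁻ : ∀ {A : Set} {z y : A} as bs → z ∈ as ++ y ∷ bs → z ≢ y → z ∈ as ++ bs
∈-++-∷⁻ []       bs (here refl) z≢y = ⊥-elim (z≢y refl)
∈-++-∷⁻ []       bs (there z∈)  z≢y = z∈
∈-++-∷⁻ (a ∷ as) bs (here refl) z≢y = here refl
∈-++-∷⁻ (a ∷ as) bs (there z∈)  z≢y = there (∈-++-∷⁻ as bs z∈ z≢y)

Unique-⊆⇒length≤ : ∀ {A : Set} {ys xs : List A} → Unique ys → (∀ {z} → z ∈ ys → z ∈ xs) → length ys ≤ length xs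
Unique-⊆⇒length≤ {ys = []} _ _ = z≤n
Unique-⊆⇒length≤ {ys = y ∷ ys} (y∉ ∷ ys!) ys⊆xs with ∈-∃++ (ys⊆xs (here refl))
... | as , bs , refl = begin
  suc (length ys)                 ≤⟨ s≤s (Unique-⊆⇒length≤ ys! ys⊆as++bs) ⟩
  suc (length (as ++ bs))         ≡⟨ cong suc (length-++ as) ⟩
  suc (length as + length bs)     ≡⟨ sym (+-suc (length as) (length bs)) ⟩
  length as + length (y ∷ bs)     ≡⟨ sym (length-++ as) ⟩
  length (as ++ y ∷ bs)           ∎
  where
  open ≤-Reasoning
  ys⊆as++bs : ∀ {z} → z ∈ ys → z ∈ as ++ bs
  ys⊆as++bs z∈ = ∈-++-∷⁻ as bs (ys⊆xs (there z∈)) (λ e → All.lookup y∉ z∈ (sym e))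

applyUpTo-cong-< : ∀ {A : Set} (f g : ℕ → A) n → (∀ j → j < n → f j ≡ g j) → applyUpTo f n ≡ applyUpTo g n
applyUpTo-cong-< f g n f≡g = begin
  applyUpTo f n      ≡⟨ map-upTo f n ⟨
  map f (upTo n)     ≡⟨ map-cong-local (All.tabulate λ j∈ → f≡g _ (∈-upTo⁻ j∈)) ⟩
  map g (upTo n)     ≡⟨ map-upTo g n ⟩
  applyUpTo g n      ∎
  where open ≡-Reasoning

take-suc-∷ʳ : ∀ {A : Set} m (l : List A) → m < length l → ∃ λ x → take (suc m) l ≡ take m l ++ [ x ]
take-suc-∷ʳ zero    (x ∷ l) _         = x , refl
take-suc-∷ʳ (suc m) (y ∷ l) (s≤s m<l) with take-suc-∷ʳ m l m<l
... | x , e = x , cong (y ∷_) e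

drop-∷ : ∀ {A : Set} j (w : List A) → j < length w → ∃ λ y → drop j w ≡ y ∷ drop (suc j) w
drop-∷ zero    (y ∷ w) _         = y , refl
drop-∷ (suc j) (z ∷ w) (s≤s j<w) = drop-∷ j w j<w

length-map-∷ʳ : ∀ (g : ℕ → ℕ) w b → length (map g w ++ [ b ]) ≡ suc (length w)
length-map-∷ʳ g w b = trans (length-++ (map g w)) (trans (+-comm _ 1) (cong suc (length-map g w)))

drop-++ˡ : ∀ {A : Set} k (xs ys : List A) → k ≤ length xs → drop k (xs ++ ys) ≡ drop k xs ++ ys
drop-++ˡ zero    xs       ys _         = refl
drop-++ˡ (suc k) (x ∷ xs) ys (s≤s k≤) = drop-++ˡ k xs ys k≤

take-++ˡ : ∀ {A : Set} k (xs ys : List A) → k ≤ length xs → take k (xs ++ ys) ≡ take k xs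
take-++ˡ zero    xs       ys _         = refl
take-++ˡ (suc k) (x ∷ xs) ys (s≤s k≤) = cong (x ∷_) (take-++ˡ k xs ys k≤)

findᵇ-sound : ∀ {A : Set} (p : A → Bool) l {b} → findᵇ p l ≡ just b → T (p b)
findᵇ-sound p (y ∷ l) e with p y in py
findᵇ-sound p (y ∷ l) refl | true = subst T (sym py) _
... | false = findᵇ-sound p l e

findᵇ-complete : ∀ {A : Set} (p : A → Bool) l {x} → x ∈ l → T (p x) → findᵇ p l ≢ nothing
findᵇ-complete p (y ∷ l) x∈ px with p y in py
... | true = λ ()
findᵇ-complete p (y ∷ l) (here refl) px | false = ⊥-elim (subst T py px)
findᵇ-complete p (y ∷ l) (there x∈) px | false = findᵇ-complete p l x∈ px

findᵇ-applyUpTo-just : ∀ {A : Set} (p : A → Bool) (f : ℕ → A) n {y} → findᵇ p (applyUpTo f n) ≡ just y →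
  ∃ λ j → j < n × y ≡ f j × p (f j) ≡ true × (∀ j′ → j′ < j → p (f j′) ≡ false)
findᵇ-applyUpTo-just p f (suc n) e with p (f 0) in p0
findᵇ-applyUpTo-just p f (suc n) refl | true = 0 , z<s , refl , p0 , λ _ ()
... | false with findᵇ-applyUpTo-just p (f ∘ suc) n e
... | j , j< , refl , pj , earlier = suc j , s≤s j< , refl , pj , λ
  { zero    _           → p0
  ; (suc j′) (s≤s j′<j) → earlier j′ j′<j }

findᵇ-applyUpTo-nothing : ∀ {A : Set} (p : A → Bool) (f : ℕ → A) n → findᵇ p (applyUpTo f n) ≡ nothing → ∀ j → j < n → p (f j) ≡ false
findᵇ-applyUpTo-nothing p f (suc n) e j j< with p (f 0) in p0
findᵇ-applyUpTo-nothing p f (suc n) () j j< | true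
findᵇ-applyUpTo-nothing p f (suc n) e zero    _         | false = p0
findᵇ-applyUpTo-nothing p f (suc n) e (suc j) (s≤s j<) | false = findᵇ-applyUpTo-nothing p (f ∘ suc) n e j j<

maxList-upper : ∀ {x} l → x ∈ l → x ≤ maxList l
maxList-upper (y ∷ l) (here refl) = m≤m⊔n y (maxList l)
maxList-upper (y ∷ l) (there x∈l) = ≤-trans (maxList-upper l x∈l) (m≤n⊔m y (maxList l))

oneTo : ℕ → List ℕ
oneTo n = applyUpTo suc n

length-oneTo : ∀ n → length (oneTo n) ≡ n
length-oneTo = length-applyUpTo suc

Unique-oneTo : ∀ n → Unique (oneTo n)
Unique-oneTo n = Unique.applyUpTo⁺₁ suc n (λ i<j _ e → <⇒≢ i<j (suc-injective e))

∈-oneTo⁺ : ∀ {n i} → 1 ≤ i → i ≤ n → i ∈ oneTo n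
∈-oneTo⁺ {i = suc i} _ i≤n = ∈-applyUpTo⁺ suc i≤n

∈-oneTo⁻ : ∀ {n i} → i ∈ oneTo n → 1 ≤ i × i ≤ n
∈-oneTo⁻ i∈ with ∈-applyUpTo⁻ suc i∈
... | _ , lt , refl = s≤s z≤n , lt

dropLast : List ℕ → List ℕ
dropLast []           = []
dropLast (x ∷ [])     = []
dropLast (x ∷ y ∷ ys) = x ∷ dropLast (y ∷ ys)

headOr0 : List ℕ → ℕ
headOr0 []      = 0
headOr0 (x ∷ _) = x

dropLast-∷ʳ : ∀ xs i → dropLast (xs ++ [ i ]) ≡ xs
dropLast-∷ʳ []           i = refl
dropLast-∷ʳ (x ∷ [])     i = refl
dropLast-∷ʳ (x ∷ y ∷ xs) i = cong (x ∷_) (dropLast-∷ʳ (y ∷ xs) i)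

lastOr0-∷ʳ : ∀ xs i → lastOr0 (xs ++ [ i ]) ≡ i
lastOr0-∷ʳ []           i = refl
lastOr0-∷ʳ (x ∷ [])     i = refl
lastOr0-∷ʳ (x ∷ y ∷ xs) i = lastOr0-∷ʳ (y ∷ xs) i

_≟ₗ_ : (u v : List ℕ) → Dec (u ≡ v)
_≟ₗ_ = ≡-dec _≟_

count : List ℕ → List (List ℕ) → ℕ
count x l = length (filter (_≟ₗ x) l)

count-map : ∀ x (f : List ℕ → List ℕ) l → count x (map f l) ≡ length (filter (λ e → f e ≟ₗ x) l)
count-map x f [] = refl
count-map x f (e ∷ l) with f e ≟ₗ x
... | yes _ = cong suc (count-map x f l)
... | no _  = count-map x f l

count-++ : ∀ x l l′ → count x (l ++ l′) ≡ count x l + count x l′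
count-++ x l l′ = trans (cong length (filter-++ (_≟ₗ x) l l′)) (length-++ (filter (_≟ₗ x) l))

count-[]-refl : ∀ x → count x [ x ] ≡ 1
count-[]-refl x with x ≟ₗ x
... | yes _  = refl
... | no x≢x = ⊥-elim (x≢x refl)

count-[]-≢ : ∀ x v → v ≢ x → count x [ v ] ≡ 0
count-[]-≢ x v v≢x with v ≟ₗ x
... | yes e = ⊥-elim (v≢x e)
... | no _  = refl

count-unique : ∀ x l → Unique l → x ∈ l → count x l ≡ 1
count-unique x (y ∷ l) (y∉ ∷ l!) x∈ with y ≟ₗ x | x∈
... | yes refl | _         = cong (suc ∘ length) (filter-none (_≟ₗ x) (All.map (λ y≢e e≡y → y≢e (sym e≡y)) y∉))
... | no y≢x   | here x≡y  = ⊥-elim (y≢x (sym x≡y))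
... | no _     | there x∈l = count-unique x l l! x∈l

wordsBelow : ℕ → ℕ → List (List ℕ)
wordsBelow B zero    = [ [] ]
wordsBelow B (suc l) = cartesianProductWith _∷_ (upTo B) (wordsBelow B l)

∈-wordsBelow : ∀ B u → All (_< B) u → u ∈ wordsBelow B (length u)
∈-wordsBelow B []      []          = here refl
∈-wordsBelow B (x ∷ u) (x<B ∷ u<B) = ∈-cartesianProductWith⁺ _∷_ (∈-upTo⁺ x<B) (∈-wordsBelow B u u<B)

-- Ranks and shifts

<ᵇ≡true⇒< : ∀ {x y} → (x <ᵇ y) ≡ true → x < y
<ᵇ≡true⇒< {x} {y} e = <ᵇ⇒< x y (subst T (sym e) _)

<ᵇ≡false⇒≥ : ∀ {x y} → (x <ᵇ y) ≡ false → y ≤ x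
<ᵇ≡false⇒≥ e = ≮⇒≥ (λ lt → subst T e (<⇒<ᵇ lt))

<⇒<ᵇ≡true : ∀ {x y} → x < y → (x <ᵇ y) ≡ true
<⇒<ᵇ≡true {x} {y} lt with x <ᵇ y in e
... | true  = refl
... | false = ⊥-elim (<⇒≱ lt (<ᵇ≡false⇒≥ e))

≥⇒<ᵇ≡false : ∀ {x y} → y ≤ x → (x <ᵇ y) ≡ false
≥⇒<ᵇ≡false {x} {y} le with x <ᵇ y in e
... | true  = ⊥-elim (<⇒≱ (<ᵇ≡true⇒< e) le)
... | false = refl

<ᵇ-cong : ∀ {x y x′ y′} → (x < y → x′ < y′) → (x′ < y′ → x < y) → (x <ᵇ y) ≡ (x′ <ᵇ y′)
<ᵇ-cong {x} {y} {x′} {y′} to from with x <ᵇ y in e | x′ <ᵇ y′ in e′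
... | true  | true  = refl
... | false | false = refl
... | true  | false = ⊥-elim (<⇒≱ (to (<ᵇ≡true⇒< e)) (<ᵇ≡false⇒≥ e′))
... | false | true  = ⊥-elim (<⇒≱ (from (<ᵇ≡true⇒< e′)) (<ᵇ≡false⇒≥ e))

OrderPreserving : (ℕ → ℕ) → Set
OrderPreserving g = ∀ x y → (g x <ᵇ g y) ≡ (x <ᵇ y)

bump : ℕ → ℕ → ℕ → ℕ
bump y x r = if y <ᵇ x then suc r else r

bump-refl : ∀ x r → bump x x r ≡ r
bump-refl x r rewrite ≥⇒<ᵇ≡false (≤-refl {x}) = refl

countLess-∷ : ∀ x y u → countLess x (y ∷ u) ≡ bump y x (countLess x u)
countLess-∷ x y u with y <ᵇ x
... | true  = refl
... | false = refl

countLess-++ : ∀ x u v → countLess x (u ++ v) ≡ countLess x u + countLess x v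
countLess-++ x u v = trans (cong length (filter-++ _ u v)) (length-++ (filterᵇ (_<ᵇ x) u))

countLess-∷ʳ : ∀ x u y → countLess x (u ++ [ y ]) ≡ bump y x (countLess x u)
countLess-∷ʳ x u y rewrite countLess-++ x u [ y ] | countLess-∷ x y [] with y <ᵇ x
... | true  = +-comm (countLess x u) 1
... | false = +-identityʳ _

countLess≤length : ∀ x u → countLess x u ≤ length u
countLess≤length x u = length-filter (T? ∘ (_<ᵇ x)) u

countLess-mono-≤ : ∀ {x y} u → x ≤ y → countLess x u ≤ countLess y u
countLess-mono-≤ [] le = z≤n
countLess-mono-≤ {x} {y} (z ∷ u) le rewrite countLess-∷ x z u | countLess-∷ y z u
  with z <ᵇ x in e | z <ᵇ y in e′
... | true  | true  = s≤s (countLess-mono-≤ u le)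
... | false | false = countLess-mono-≤ u le
... | false | true  = m≤n⇒m≤1+n (countLess-mono-≤ u le)
... | true  | false = ⊥-elim (<⇒≱ (<-≤-trans (<ᵇ≡true⇒< e) le) (<ᵇ≡false⇒≥ e′))

countLess-mono-< : ∀ {x y} u → x ∈ u → x < y → countLess x u < countLess y u
countLess-mono-< {x} {y} (z ∷ u) (here refl) lt
  rewrite countLess-∷ y z u | countLess-∷ z z u | <⇒<ᵇ≡true lt | bump-refl z (countLess z u)
  = s≤s (countLess-mono-≤ u (<⇒≤ lt))
countLess-mono-< {x} {y} (z ∷ u) (there x∈u) lt rewrite countLess-∷ x z u | countLess-∷ y z u
  with z <ᵇ x in e | z <ᵇ y in e′
... | true  | true  = s≤s (countLess-mono-< u x∈u lt)
... | false | false = countLess-mono-< u x∈u lt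
... | false | true  = m<n⇒m<1+n (countLess-mono-< u x∈u lt)
... | true  | false = ⊥-elim (<⇒≱ (<-trans (<ᵇ≡true⇒< e) lt) (<ᵇ≡false⇒≥ e′))

countLess<length : ∀ {x} u → x ∈ u → countLess x u < length u
countLess<length {x} (y ∷ u) (here refl) rewrite countLess-∷ y y u | bump-refl y (countLess y u) =
  s≤s (countLess≤length y u)
countLess<length {x} (y ∷ u) (there x∈u) rewrite countLess-∷ x y u with y <ᵇ x
... | true  = s≤s (countLess<length u x∈u)
... | false = m<n⇒m<1+n (countLess<length u x∈u)

countLess-all< : ∀ x u → All (_< x) u → countLess x u ≡ length u
countLess-all< x [] [] = refl
countLess-all< x (y ∷ u) (y<x ∷ u<x) rewrite countLess-∷ x y u | <⇒<ᵇ≡true y<x =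
  cong suc (countLess-all< x u u<x)

countLess-all> : ∀ x u → All (x <_) u → countLess x u ≡ 0
countLess-all> x [] [] = refl
countLess-all> x (y ∷ u) (x<y ∷ x<u) rewrite countLess-∷ x y u | ≥⇒<ᵇ≡false (<⇒≤ x<y) =
  countLess-all> x u x<u

countLess-map : ∀ {g} → OrderPreserving g → ∀ x u → countLess (g x) (map g u) ≡ countLess x u
countLess-map g-op x [] = refl
countLess-map {g} g-op x (y ∷ u)
  rewrite countLess-∷ (g x) (g y) (map g u) | countLess-∷ x y u | g-op y x =
  cong (bump y x) (countLess-map g-op x u)

countLess-resp-↭ : ∀ x {u v} → u ↭ v → countLess x u ≡ countLess x v
countLess-resp-↭ x p = ↭-length (filter-↭ (λ y → T? (y <ᵇ x)) p)

countLess-upTo : ∀ n y → y ≤ n → countLess y (upTo n) ≡ y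
countLess-upTo zero    zero _  = refl
countLess-upTo (suc n) y    y≤ = begin
  countLess y (upTo (suc n))           ≡⟨ cong (countLess y) (upTo-∷ʳ n) ⟨
  countLess y (upTo n ++ [ n ])        ≡⟨ countLess-∷ʳ y (upTo n) n ⟩
  bump n y (countLess y (upTo n))      ≡⟨ last-letter (m≤n⇒m<n∨m≡n y≤) ⟩
  y                                    ∎
  where
  open ≡-Reasoning
  last-letter : y < suc n ⊎ y ≡ suc n → bump n y (countLess y (upTo n)) ≡ y
  last-letter (inj₁ (s≤s y≤n)) rewrite ≥⇒<ᵇ≡false y≤n = countLess-upTo n y y≤n
  last-letter (inj₂ refl) rewrite <⇒<ᵇ≡true (≤-refl {suc n}) =
    cong suc (trans (countLess-all< (suc n) (upTo n) (All.tabulate (m<n⇒m<1+n ∘ ∈-upTo⁻))) (length-upTo n))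

rank-surjective : ∀ π → Unique π → ∀ j → j < length π → ∃ λ x → x ∈ π × countLess x π ≡ j
rank-surjective π π! j j< with j ∈? map (λ x → countLess x π) π
... | yes j∈ with ∈-map⁻ (λ x → countLess x π) j∈
...   | x , x∈ , e = x , x∈ , sym e
rank-surjective π π! j j< | no j∉ = ⊥-elim (<-irrefl refl (begin-strict
  length π                     ≡⟨ length-map rank π ⟨
  length (map rank π)          <⟨ n<1+n _ ⟩
  length (j ∷ map rank π)      ≤⟨ Unique-⊆⇒length≤ (All.tabulate (λ r∈ e → j∉ (subst (_∈ _) (sym e) r∈)) ∷ ranks!) ranks⊆ ⟩
  length (upTo (length π))     ≡⟨ length-upTo (length π) ⟩
  length π                     ∎))
  where
  open ≤-Reasoning
  rank = λ x → countLess x π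
  rank-injective : ∀ {a b} → a ∈ π → b ∈ π → rank a ≡ rank b → a ≡ b
  rank-injective {a} {b} a∈ b∈ e with <-cmp a b
  ... | tri< a<b _ _ = ⊥-elim (<⇒≢ (countLess-mono-< π a∈ a<b) e)
  ... | tri≈ _ a≡b _ = a≡b
  ... | tri> _ _ b<a = ⊥-elim (<⇒≢ (countLess-mono-< π b∈ b<a) (sym e))
  ranks! : Unique (map rank π)
  ranks! = Unique-map⁺-local rank π! rank-injective
  ranks⊆ : ∀ {r} → r ∈ j ∷ map rank π → r ∈ upTo (length π)
  ranks⊆ (here refl) = ∈-upTo⁺ j<
  ranks⊆ (there r∈) with ∈-map⁻ rank r∈
  ... | x , x∈ , refl = ∈-upTo⁺ (countLess<length π x∈)

c-mono-< : ∀ b {x y} → x < y → c b x < c b y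
c-mono-< b {x} {y} lt with x <ᵇ b in e | y <ᵇ b in e′
... | true  | true  = lt
... | true  | false = m<n⇒m<1+n lt
... | false | true  = ⊥-elim (<⇒≱ (<-trans lt (<ᵇ≡true⇒< {y} {b} e′)) (<ᵇ≡false⇒≥ {x} {b} e))
... | false | false = s≤s lt

c-orderPreserving : ∀ b → OrderPreserving (c b)
c-orderPreserving b x y = <ᵇ-cong from (c-mono-< b)
  where
  from : c b x < c b y → x < y
  from lt with <-cmp x y
  ... | tri< x<y _ _ = x<y
  ... | tri≈ _ refl _ = ⊥-elim (<-irrefl refl lt)
  ... | tri> _ _ y<x = ⊥-elim (<-asym lt (c-mono-< b y<x))

c-injective : ∀ b {x y} → c b x ≡ c b y → x ≡ y
c-injective b {x} {y} e with <-cmp x y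
... | tri< x<y _ _ = ⊥-elim (<⇒≢ (c-mono-< b x<y) e)
... | tri≈ _ x≡y _ = x≡y
... | tri> _ _ y<x = ⊥-elim (<⇒≢ (c-mono-< b y<x) (sym e))

c≢pivot : ∀ b x → c b x ≢ b
c≢pivot b x e with x <ᵇ b in lt
... | true  = <⇒≢ (<ᵇ≡true⇒< lt) e
... | false = <⇒≢ (s≤s (<ᵇ≡false⇒≥ {x} {b} lt)) (sym e)

c-<ᵇ-pivot : ∀ b x → (c b x <ᵇ b) ≡ (x <ᵇ b)
c-<ᵇ-pivot b x with x <ᵇ b in e
... | true  = e
... | false = ≥⇒<ᵇ≡false {suc x} {b} (m≤n⇒m≤1+n (<ᵇ≡false⇒≥ {x} {b} e))

c-below : ∀ b {x} → x < b → c b x ≡ x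
c-below b lt rewrite <⇒<ᵇ≡true lt = refl

pivot∉map-c : ∀ b u → b ∉ map (c b) u
pivot∉map-c b u b∈ with ∈-map⁻ (c b) b∈
... | x , _ , e = c≢pivot b x (sym e)

uncut : ℕ → ℕ → ℕ
uncut b y = if y <ᵇ b then y else pred y

uncut-c : ∀ b x → uncut b (c b x) ≡ x
uncut-c b x with x <ᵇ b in e
... | true rewrite e = refl
... | false rewrite ≥⇒<ᵇ≡false {suc x} {b} (m≤n⇒m≤1+n (<ᵇ≡false⇒≥ e)) = refl

map-uncut-c : ∀ b v → map (uncut b) (map (c b) v) ≡ v
map-uncut-c b v = trans (sym (map-∘ v)) (trans (map-cong (uncut-c b) v) (map-id v))

countLess-map-c : ∀ b u → countLess b (map (c b) u) ≡ countLess b u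
countLess-map-c b [] = refl
countLess-map-c b (y ∷ u) rewrite countLess-∷ b (c b y) (map (c b) u) | countLess-∷ b y u | c-<ᵇ-pivot b y =
  cong (bump y b) (countLess-map-c b u)

-- Reduced forms

red-map : ∀ {g} → OrderPreserving g → ∀ u → red (map g u) ≡ red u
red-map g-op u = trans (sym (map-∘ u)) (map-cong (λ x → cong suc (countLess-map g-op x u)) u)

-- extendʳ v i is the pattern of the i-th extension of any word with pattern v, and
-- extendˡ k v that of any word with pattern v preceded by a letter of rank k.
extendʳ : List ℕ → ℕ → List ℕ
extendʳ v i = map (c i) v ++ [ i ]

extendˡ : ℕ → List ℕ → List ℕ
extendˡ k v = k ∷ map (c k) v

rank-insert : ∀ {x y} u → y ∈ u → x ∉ u →
  suc (bump x y (countLess y u)) ≡ c (suc (countLess x u)) (suc (countLess y u))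
rank-insert {x} {y} u y∈u x∉u with <-cmp x y
... | tri< x<y _ _ rewrite <⇒<ᵇ≡true x<y | ≥⇒<ᵇ≡false (countLess-mono-≤ u (<⇒≤ x<y)) = refl
... | tri≈ _ refl _ = ⊥-elim (x∉u y∈u)
... | tri> _ _ y<x rewrite ≥⇒<ᵇ≡false (<⇒≤ y<x) | <⇒<ᵇ≡true (countLess-mono-< u y∈u y<x) = refl

red-∷ʳ : ∀ u x → x ∉ u → red (u ++ [ x ]) ≡ extendʳ (red u) (suc (countLess x u))
red-∷ʳ u x x∉u = begin
  map rank (u ++ [ x ])             ≡⟨ map-++ rank u [ x ] ⟩
  map rank u ++ [ rank x ]          ≡⟨ cong₂ (λ v y → v ++ [ y ]) shifted pivot ⟩
  extendʳ (red u) (suc (countLess x u)) ∎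
  where
  open ≡-Reasoning
  rank = λ y → suc (countLess y (u ++ [ x ]))
  shifted : map rank u ≡ map (c (suc (countLess x u))) (red u)
  shifted = trans (map-cong-local (All.tabulate λ {y} y∈u →
              trans (cong suc (countLess-∷ʳ y u x)) (rank-insert u y∈u x∉u))) (map-∘ u)
  pivot : rank x ≡ suc (countLess x u)
  pivot = cong suc (trans (countLess-∷ʳ x u x) (bump-refl x _))

red-∷ : ∀ x u → x ∉ u → red (x ∷ u) ≡ extendˡ (suc (countLess x u)) (red u)
red-∷ x u x∉u = cong₂ _∷_
  (cong suc (trans (countLess-∷ x x u) (bump-refl x _)))
  (trans (map-cong-local (All.tabulate λ {y} y∈u →
     trans (cong suc (countLess-∷ y x u)) (rank-insert u y∈u x∉u))) (map-∘ u))

red-extension : ∀ b π → red (map (c b) π ++ [ b ]) ≡ extendʳ (red π) (suc (countLess b π))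
red-extension b π = trans (red-∷ʳ (map (c b) π) b (pivot∉map-c b π))
  (cong₂ (λ v k → extendʳ v (suc k)) (red-map (c-orderPreserving b) π) (countLess-map-c b π))

red-rotate : ∀ a γ {B} → a ∉ γ → All (_< B) (a ∷ γ) →
  extendʳ (red (a ∷ γ)) (suc (length (a ∷ γ))) ≡ extendˡ (suc (countLess a (γ ++ [ B ]))) (red (γ ++ [ B ]))
red-rotate a γ {B} a∉γ below = begin
  extendʳ (red (a ∷ γ)) (suc (length (a ∷ γ)))       ≡⟨ cong (extendʳ (red (a ∷ γ)) ∘ suc) (countLess-all< B (a ∷ γ) below) ⟨
  extendʳ (red (a ∷ γ)) (suc (countLess B (a ∷ γ)))  ≡⟨ red-∷ʳ (a ∷ γ) B (λ B∈ → <-irrefl refl (All.lookup below B∈)) ⟨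
  red (a ∷ γ ++ [ B ])                               ≡⟨ red-∷ a (γ ++ [ B ]) a∉γ++B ⟩
  extendˡ (suc (countLess a (γ ++ [ B ]))) (red (γ ++ [ B ])) ∎
  where
  open ≡-Reasoning
  a∉γ++B : a ∉ γ ++ [ B ]
  a∉γ++B a∈ with ∈-++⁻ γ a∈
  ... | inj₁ a∈γ = a∉γ a∈γ
  ... | inj₂ (here refl) = <-irrefl refl (All.lookup below (here refl))

red-increasing : ∀ β → AllPairs _<_ β → red β ≡ oneTo (length β)
red-increasing [] [] = refl
red-increasing (x ∷ β) (x<β ∷ β↑) = begin
  red (x ∷ β)                                ≡⟨ red-∷ x β (λ x∈β → <-irrefl refl (All.lookup x<β x∈β)) ⟩
  extendˡ (suc (countLess x β)) (red β)      ≡⟨ cong₂ (λ k v → extendˡ (suc k) v) (countLess-all> x β x<β) (red-increasing β β↑) ⟩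
  1 ∷ map (c 1) (oneTo (length β))           ≡⟨ cong (1 ∷_) (trans (map-cong-local (All.tabulate c1≡suc)) (map-applyUpTo suc suc (length β))) ⟩
  oneTo (suc (length β))                     ∎
  where
  open ≡-Reasoning
  c1≡suc : ∀ {y} → y ∈ oneTo (length β) → c 1 y ≡ suc y
  c1≡suc y∈ with ∈-oneTo⁻ y∈
  ... | s≤s z≤n , _ = refl

red-permutation : ∀ n p → p ↭ map suc (upTo n) → red p ≡ p
red-permutation n p p↭ = trans (map-cong-local (All.tabulate rank≡)) (map-id p)
  where
  rank≡ : ∀ {x} → x ∈ p → suc (countLess x p) ≡ x
  rank≡ x∈ with ∈-map⁻ suc (∈-resp-↭ p↭ x∈)
  ... | y , y∈ , refl = cong suc (begin
    countLess (suc y) p                    ≡⟨ countLess-resp-↭ (suc y) p↭ ⟩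
    countLess (suc y) (map suc (upTo n))   ≡⟨ countLess-map (λ _ _ → refl) y (upTo n) ⟩
    countLess y (upTo n)                   ≡⟨ countLess-upTo n y (<⇒≤ (∈-upTo⁻ y∈)) ⟩
    y                                      ∎)
    where open ≡-Reasoning

red-bounded : ∀ u → All (_< suc (length u)) (red u)
red-bounded u = All.map⁺ (All.tabulate λ x∈ → s≤s (countLess<length u x∈))

-- The pattern graph

source : List ℕ → List ℕ
source e = map (uncut (lastOr0 e)) (dropLast e)

target : List ℕ → List ℕ
target e = map (uncut (headOr0 e)) (drop 1 e)

lastOr0-extendʳ : ∀ v i → lastOr0 (extendʳ v i) ≡ i
lastOr0-extendʳ v i = lastOr0-∷ʳ (map (c i) v) i

source-extendʳ : ∀ v i → source (extendʳ v i) ≡ v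
source-extendʳ v i rewrite lastOr0-extendʳ v i | dropLast-∷ʳ (map (c i) v) i = map-uncut-c i v

target-extendˡ : ∀ k v → target (extendˡ k v) ≡ v
target-extendˡ k v = map-uncut-c k v

OutSaturated : ℕ → List (List ℕ) → List ℕ → Set
OutSaturated m L x = ∀ i → 1 ≤ i → i ≤ suc m → extendʳ x i ∈ L

InSaturated : ℕ → List (List ℕ) → List ℕ → Set
InSaturated m L x = ∀ k → 1 ≤ k → k ≤ suc m → extendˡ k x ∈ L

GreedyClosed : List (List ℕ) → Set
GreedyClosed L = ∀ {e} → e ∈ L → ∀ i → 1 ≤ i → i < lastOr0 e → extendʳ (source e) i ∈ L

topEdge⇒OutSaturated : ∀ {m L} → GreedyClosed L → ∀ x → extendʳ x (suc m) ∈ L → OutSaturated m L x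
topEdge⇒OutSaturated {m} {L} greedy x top i 1≤i i≤ with m≤n⇒m<n∨m≡n i≤
... | inj₂ refl = top
... | inj₁ i< = subst (λ v → extendʳ v i ∈ L) (source-extendʳ x (suc m))
  (greedy top i 1≤i (subst (i <_) (sym (lastOr0-extendʳ x (suc m))) i<))

module Trail (m : ℕ) (L : List (List ℕ)) (origin terminus : List ℕ)
  (L! : Unique L)
  (walk : map source L ++ [ terminus ] ≡ origin ∷ map target L)
  (edge-shape : ∀ {e} → e ∈ L → e ≡ extendˡ (headOr0 e) (target e) × 1 ≤ headOr0 e × headOr0 e ≤ suc m)
  where

  outEdges : List ℕ → List (List ℕ)
  outEdges x = filter (λ e → source e ≟ₗ x) L

  inEdges : List ℕ → List (List ℕ)
  inEdges x = filter (λ e → target e ≟ₗ x) L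

  flow : ∀ x → length (outEdges x) + count x [ terminus ] ≡ count x [ origin ] + length (inEdges x)
  flow x = begin
    length (outEdges x) + count x [ terminus ]     ≡⟨ cong (_+ count x [ terminus ]) (count-map x source L) ⟨
    count x (map source L) + count x [ terminus ]  ≡⟨ count-++ x (map source L) [ terminus ] ⟨
    count x (map source L ++ [ terminus ])         ≡⟨ cong (count x) walk ⟩
    count x (origin ∷ map target L)                ≡⟨ count-++ x [ origin ] (map target L) ⟩
    count x [ origin ] + count x (map target L)    ≡⟨ cong (count x [ origin ] +_) (count-map x target L) ⟩
    count x [ origin ] + length (inEdges x)        ∎
    where open ≡-Reasoning

  Unique-heads-inEdges : ∀ x → Unique (map headOr0 (inEdges x))
  Unique-heads-inEdges x = Unique-map⁺-local headOr0 (Unique.filter⁺ (λ e → target e ≟ₗ x) L!) same-head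
    where
    same-head : ∀ {a b} → a ∈ inEdges x → b ∈ inEdges x → headOr0 a ≡ headOr0 b → a ≡ b
    same-head a∈ b∈ e with ∈-filter⁻ (λ e → target e ≟ₗ x) a∈ | ∈-filter⁻ (λ e → target e ≟ₗ x) b∈
    ... | a∈L , ta | b∈L , tb =
      trans (proj₁ (edge-shape a∈L)) (trans (cong₂ extendˡ e (trans ta (sym tb))) (sym (proj₁ (edge-shape b∈L))))

  heads-inEdges⊆oneTo : ∀ x {k} → k ∈ map headOr0 (inEdges x) → k ∈ oneTo (suc m)
  heads-inEdges⊆oneTo x k∈ with ∈-map⁻ headOr0 k∈
  ... | e , e∈ , refl with edge-shape (proj₁ (∈-filter⁻ (λ e → target e ≟ₗ x) e∈))
  ... | _ , 1≤k , k≤ = ∈-oneTo⁺ 1≤k k≤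

  inDegree≤ : ∀ x → length (inEdges x) ≤ suc m
  inDegree≤ x = subst₂ _≤_ (length-map headOr0 (inEdges x)) (length-oneTo (suc m))
    (Unique-⊆⇒length≤ (Unique-heads-inEdges x) (heads-inEdges⊆oneTo x))

  inDegree≥⇒InSaturated : ∀ x → suc m ≤ length (inEdges x) → InSaturated m L x
  inDegree≥⇒InSaturated x full k 1≤k k≤ with k ∈? map headOr0 (inEdges x)
  ... | yes k∈ with ∈-map⁻ headOr0 k∈
  ...   | e , e∈ , refl with ∈-filter⁻ (λ e → target e ≟ₗ x) e∈
  ...     | e∈L , te = subst (_∈ L) (trans (proj₁ (edge-shape e∈L)) (cong (extendˡ (headOr0 e)) te)) e∈L
  inDegree≥⇒InSaturated x full k 1≤k k≤ | no k∉ = ⊥-elim (<⇒≱ (s≤s full) too-many)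
    where
    heads = map headOr0 (inEdges x)
    too-many : suc (length (inEdges x)) ≤ suc m
    too-many = subst₂ _≤_ (cong suc (length-map headOr0 (inEdges x))) (length-oneTo (suc m))
      (Unique-⊆⇒length≤ (All.tabulate (λ h∈ e → k∉ (subst (_∈ heads) (sym e) h∈)) ∷ Unique-heads-inEdges x)
        λ { (here refl) → ∈-oneTo⁺ 1≤k k≤ ; (there h∈) → heads-inEdges⊆oneTo x h∈ })

  OutSaturated⇒outDegree≥ : ∀ x → OutSaturated m L x → suc m ≤ length (outEdges x)
  OutSaturated⇒outDegree≥ x sat = subst₂ _≤_ (length-oneTo (suc m)) (length-map lastOr0 (outEdges x))
    (Unique-⊆⇒length≤ (Unique-oneTo (suc m)) last∈)
    where
    last∈ : ∀ {i} → i ∈ oneTo (suc m) → i ∈ map lastOr0 (outEdges x)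
    last∈ i∈ with ∈-oneTo⁻ i∈
    ... | 1≤i , i≤ = subst (_∈ _) (lastOr0-extendʳ x _)
      (∈-map⁺ lastOr0 (∈-filter⁺ (λ e → source e ≟ₗ x) (sat _ 1≤i i≤) (source-extendʳ x _)))

  OutSaturated-terminus⇒closed : OutSaturated m L terminus → terminus ≡ origin
  OutSaturated-terminus⇒closed sat with terminus ≟ₗ origin
  ... | yes e = e
  ... | no terminus≢origin = ⊥-elim (<⇒≱ (begin-strict
      suc m                                                     ≤⟨ OutSaturated⇒outDegree≥ terminus sat ⟩
      length (outEdges terminus)                                <⟨ m<m+n _ (subst (0 <_) (sym (count-[]-refl terminus)) z<s) ⟩
      length (outEdges terminus) + count terminus [ terminus ]  ≡⟨ flow terminus ⟩
      count terminus [ origin ] + length (inEdges terminus)     ≡⟨ cong (_+ length (inEdges terminus)) origin-uncounted ⟩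
      length (inEdges terminus)                                 ∎) (inDegree≤ terminus))
    where
    open ≤-Reasoning
    origin-uncounted : count terminus [ origin ] ≡ 0
    origin-uncounted = count-[]-≢ terminus origin (terminus≢origin ∘ sym)

  OutSaturated⇒InSaturated : terminus ≡ origin → ∀ x → OutSaturated m L x → InSaturated m L x
  OutSaturated⇒InSaturated closed x sat =
    inDegree≥⇒InSaturated x (subst (suc m ≤_) balanced (OutSaturated⇒outDegree≥ x sat))
    where
    balanced : length (outEdges x) ≡ length (inEdges x)
    balanced = +-cancelʳ-≡ _ _ _ (begin
      length (outEdges x) + count x [ terminus ] ≡⟨ flow x ⟩
      count x [ origin ] + length (inEdges x)    ≡⟨ cong (λ v → count x [ v ] + length (inEdges x)) closed ⟨
      count x [ terminus ] + length (inEdges x)  ≡⟨ +-comm (count x [ terminus ]) _ ⟩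
      length (inEdges x) + count x [ terminus ]  ∎)
      where open ≡-Reasoning

  module SpanningTree (greedy : GreedyClosed L) (origin≡oneTo : origin ≡ oneTo m) (stuck : OutSaturated m L terminus) where

    closed : terminus ≡ origin
    closed = OutSaturated-terminus⇒closed stuck

    OutSaturated-red : ∀ α β → Unique (α ++ β) → length (α ++ β) ≡ m →
      AllPairs _<_ β → OutSaturated m L (red (α ++ β))
    OutSaturated-red [] β _ len β↑ = subst (OutSaturated m L)
      (trans closed (trans origin≡oneTo (trans (cong oneTo (sym len)) (sym (red-increasing β β↑))))) stuck
    OutSaturated-red (a ∷ α) β aγ!@(_ ∷ γ!) len β↑ = topEdge⇒OutSaturated greedy (red (a ∷ γ))
      (subst (λ k → extendʳ (red (a ∷ γ)) (suc k) ∈ L) len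
        (subst (_∈ L) (sym (red-rotate a γ (Unique.Unique[x∷xs]⇒x∉xs aγ!) below)) in∈L))
      where
      γ = α ++ β
      B = suc (maxList (a ∷ γ))
      below : All (_< B) (a ∷ γ)
      below = All.tabulate (λ y∈ → s≤s (maxList-upper (a ∷ γ) y∈))
      γB≡ : γ ++ [ B ] ≡ α ++ (β ++ [ B ])
      γB≡ = ++-assoc α β [ B ]
      length-γB : length (γ ++ [ B ]) ≡ m
      length-γB = trans (length-++ γ) (trans (+-comm _ 1) len)
      γB! : Unique (γ ++ [ B ])
      γB! = Unique-∷ʳ⁺ γ! (λ B∈ → <-irrefl refl (All.lookup below (there B∈)))
      IH : OutSaturated m L (red (γ ++ [ B ]))
      IH = subst (OutSaturated m L ∘ red) (sym γB≡) (OutSaturated-red α (β ++ [ B ])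
        (subst Unique γB≡ γB!) (trans (cong length (sym γB≡)) length-γB)
        (AllPairs.++⁺ β↑ ([] ∷ []) (All.tabulate λ b∈ → All.lookup below (there (∈-++⁺ʳ α b∈)) ∷ [])))
      in∈L : extendˡ (suc (countLess a (γ ++ [ B ]))) (red (γ ++ [ B ])) ∈ L
      in∈L = OutSaturated⇒InSaturated closed _ IH _ (s≤s z≤n)
        (s≤s (subst (countLess a (γ ++ [ B ]) ≤_) length-γB (countLess≤length a (γ ++ [ B ]))))

    red∈L : ∀ p → Unique p → length p ≡ suc m → red p ∈ L
    red∈L p p! len with initLast p
    ... | [] with () ← len
    ... | ρ ∷ʳ′ x with Unique-∷ʳ⁻ ρ p!
    ...   | ρ! , x∉ρ = subst (_∈ L) (sym (red-∷ʳ ρ x x∉ρ))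
      (ρ-sat _ (s≤s z≤n) (s≤s (subst (countLess x ρ ≤_) length-ρ (countLess≤length x ρ))))
      where
      length-ρ : length ρ ≡ m
      length-ρ = suc-injective (trans (+-comm 1 (length ρ)) (trans (sym (length-++ ρ)) len))
      ρ-sat : OutSaturated m L (red ρ)
      ρ-sat = subst (OutSaturated m L ∘ red) (++-identityʳ ρ) (OutSaturated-red ρ []
        (subst Unique (sym (++-identityʳ ρ)) ρ!) (trans (cong length (++-identityʳ ρ)) length-ρ) [])

-- Factors of a word

window : ℕ → List ℕ → ℕ → List ℕ
window m w j = take (suc m) (drop j w)

vertex : ℕ → List ℕ → ℕ → List ℕ
vertex m w j = red (take m (drop j w))

patterns : ℕ → List ℕ → List (List ℕ)
patterns m w = map red (factors (suc m) w)

length-patterns : ∀ m w → length (patterns m w) ≡ length w ∸ m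
length-patterns m w = trans (length-map red (factors (suc m) w)) (length-applyUpTo (window m w) (length w ∸ m))

∈-patterns⁻ : ∀ m w {e} → e ∈ patterns m w → ∃ λ j → j < length w ∸ m × e ≡ red (window m w j)
∈-patterns⁻ m w e∈ with ∈-map⁻ red e∈
... | f , f∈ , refl with ∈-applyUpTo⁻ (window m w) f∈
... | j , j< , refl = j , j< , refl

window-bound : ∀ m (w : List ℕ) {j} → m ≤ length w → j < length w ∸ m → suc j + m ≤ length w
window-bound m w m≤ j< = m≤o∸n⇒m+n≤o _ m≤ j<

m<length-drop : ∀ m j (w : List ℕ) → suc j + m ≤ length w → m < length (drop j w)
m<length-drop m j w j+m< rewrite length-drop j w =
  m+n≤o⇒m≤o∸n (suc m) (subst (_≤ length w) (cong suc (+-comm j m)) j+m<)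

countLess-take≤ : ∀ m x (l : List ℕ) → countLess x (take m l) ≤ m
countLess-take≤ m x l = ≤-trans (countLess≤length x (take m l)) (≤-trans (≤-reflexive (length-take m l)) (m⊓n≤m m (length l)))

red-window-extendʳ : ∀ m (w : List ℕ) j → Unique w → suc j + m ≤ length w →
  ∃ λ k → red (window m w j) ≡ extendʳ (vertex m w j) (suc k) × k ≤ m
red-window-extendʳ m w j w! j+m< with take-suc-∷ʳ m (drop j w) (m<length-drop m j w j+m<)
... | x , e with Unique-∷ʳ⁻ (take m (drop j w)) (subst Unique e (Unique.take⁺ (suc m) (Unique.drop⁺ j w!)))
... | _ , x∉ = countLess x (take m (drop j w)) , trans (cong red e) (red-∷ʳ _ x x∉) , countLess-take≤ m x (drop j w)

red-window-extendˡ : ∀ m (w : List ℕ) j → Unique w → suc j + m ≤ length w →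
  ∃ λ k → red (window m w j) ≡ extendˡ (suc k) (vertex m w (suc j)) × k ≤ m
red-window-extendˡ m w j w! j+m< with drop-∷ j w (≤-trans (m≤m+n (suc j) m) j+m<)
... | y , e = countLess y (take m (drop (suc j) w)) ,
  trans (cong (red ∘ take (suc m)) e) (red-∷ y _ y∉) , countLess-take≤ m y (drop (suc j) w)
  where
  y∉ : y ∉ take m (drop (suc j) w)
  y∉ = Unique.Unique[x∷xs]⇒x∉xs (subst (Unique ∘ take (suc m)) e (Unique.take⁺ (suc m) (Unique.drop⁺ j w!)))

suffix : ℕ → List ℕ → List ℕ
suffix m u = drop (length u ∸ m) u

length-suffix : ∀ m (u : List ℕ) → m ≤ length u → length (suffix m u) ≡ m
length-suffix m u m≤ = trans (length-drop (length u ∸ m) u) (m∸[m∸n]≡n m≤)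

module Patterns (m : ℕ) (w : List ℕ) (w! : Unique w) (m≤ : m ≤ length w) where

  source-window : ∀ j → j < length w ∸ m → source (red (window m w j)) ≡ vertex m w j
  source-window j j< with red-window-extendʳ m w j w! (window-bound m w m≤ j<)
  ... | k , e , _ = trans (cong source e) (source-extendʳ _ (suc k))

  target-window : ∀ j → j < length w ∸ m → target (red (window m w j)) ≡ vertex m w (suc j)
  target-window j j< with red-window-extendˡ m w j w! (window-bound m w m≤ j<)
  ... | k , e , _ = trans (cong target e) (target-extendˡ (suc k) _)

  patterns-walk : map source (patterns m w) ++ [ red (suffix m w) ] ≡ red (take m w) ∷ map target (patterns m w)
  patterns-walk = begin
    map source (patterns m w) ++ [ red (suffix m w) ]     ≡⟨ cong (λ v → map source (patterns m w) ++ [ red v ]) (take-all m _ (≤-reflexive (length-suffix m w m≤))) ⟨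
    map source (patterns m w) ++ [ vertex m w K ]         ≡⟨ cong (_++ [ vertex m w K ]) (map-window source (vertex m w) source-window) ⟩
    applyUpTo (vertex m w) K ++ [ vertex m w K ]          ≡⟨ applyUpTo-∷ʳ (vertex m w) K ⟩
    applyUpTo (vertex m w) (suc K)                        ≡⟨ cong (vertex m w 0 ∷_) (map-window target (vertex m w ∘ suc) target-window) ⟨
    vertex m w 0 ∷ map target (patterns m w)              ∎
    where
    open ≡-Reasoning
    K = length w ∸ m
    map-window : ∀ f g → (∀ j → j < K → f (red (window m w j)) ≡ g j) → map f (patterns m w) ≡ applyUpTo g K
    map-window f g f≡g = trans (sym (map-∘ (applyUpTo (window m w) K)))
      (trans (map-applyUpTo (window m w) (f ∘ red) K) (applyUpTo-cong-< _ g K f≡g))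

  patterns-edge-shape : ∀ {e} → e ∈ patterns m w → e ≡ extendˡ (headOr0 e) (target e) × 1 ≤ headOr0 e × headOr0 e ≤ suc m
  patterns-edge-shape e∈ with ∈-patterns⁻ m w e∈
  ... | j , j< , refl with red-window-extendˡ m w j w! (window-bound m w m≤ j<)
  ... | k , e , k≤ rewrite e | target-extendˡ (suc k) (vertex m w (suc j)) = refl , s≤s z≤n , s≤s k≤

factors-map : ∀ n (g : ℕ → ℕ) w → factors n (map g w) ≡ map (map g) (factors n w)
factors-map n g w = begin
  applyUpTo (λ i → take n (drop i (map g w))) (suc (length (map g w)) ∸ n)
    ≡⟨ cong (λ l → applyUpTo (λ i → take n (drop i (map g w))) (suc l ∸ n)) (length-map g w) ⟩
  applyUpTo (λ i → take n (drop i (map g w))) (suc (length w) ∸ n)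
    ≡⟨ applyUpTo-cong-< _ _ _ (λ i _ → trans (cong (take n) (drop-map i w)) (take-map n (drop i w))) ⟩
  applyUpTo (map g ∘ (λ i → take n (drop i w))) (suc (length w) ∸ n)
    ≡⟨ map-applyUpTo _ (map g) _ ⟨
  map (map g) (factors n w) ∎
  where open ≡-Reasoning

factors-∷ʳ : ∀ m (u : List ℕ) b → m ≤ length u →
  factors (suc m) (u ++ [ b ]) ≡ factors (suc m) u ++ [ suffix m u ++ [ b ] ]
factors-∷ʳ m u b m≤ = begin
  applyUpTo (window m (u ++ [ b ])) (length (u ++ [ b ]) ∸ m)  ≡⟨ cong (applyUpTo _) count≡ ⟩
  applyUpTo (window m (u ++ [ b ])) (suc K)                    ≡⟨ applyUpTo-∷ʳ _ K ⟨
  applyUpTo (window m (u ++ [ b ])) K ++ [ window m (u ++ [ b ]) K ]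
    ≡⟨ cong₂ (λ l f → l ++ [ f ]) (applyUpTo-cong-< _ _ K inner) final ⟩
  factors (suc m) u ++ [ suffix m u ++ [ b ] ]                 ∎
  where
  open ≡-Reasoning
  K = length u ∸ m
  count≡ : length (u ++ [ b ]) ∸ m ≡ suc K
  count≡ = trans (cong (_∸ m) (trans (length-++ u) (+-comm _ 1))) (+-∸-assoc 1 m≤)
  inner : ∀ j → j < K → window m (u ++ [ b ]) j ≡ window m u j
  inner j j< = trans (cong (take (suc m)) (drop-++ˡ j u [ b ] (≤-trans (n≤1+n j) (≤-trans (m≤m+n (suc j) m) j+m<))))
    (take-++ˡ (suc m) (drop j u) [ b ] (m<length-drop m j u j+m<))
    where
    j+m< : suc j + m ≤ length u
    j+m< = window-bound m u m≤ j<
  final : window m (u ++ [ b ]) K ≡ suffix m u ++ [ b ]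
  final = trans (cong (take (suc m)) (drop-++ˡ K u [ b ] (m∸n≤m (length u) m)))
    (take-all (suc m) _ (≤-reflexive (trans (length-++ (suffix m u)) (trans (+-comm _ 1) (cong suc (length-suffix m u m≤))))))

patterns-∷ʳ : ∀ m w b → m ≤ length w →
  patterns m (map (c b) w ++ [ b ]) ≡ patterns m w ++ [ red (map (c b) (suffix m w) ++ [ b ]) ]
patterns-∷ʳ m w b m≤ = begin
  map red (factors (suc m) (map (c b) w ++ [ b ]))
    ≡⟨ cong (map red) (factors-∷ʳ m (map (c b) w) b (subst (m ≤_) (sym (length-map (c b) w)) m≤)) ⟩
  map red (factors (suc m) (map (c b) w) ++ [ suffix m (map (c b) w) ++ [ b ] ])
    ≡⟨ cong (λ s → map red (factors (suc m) (map (c b) w) ++ [ s ++ [ b ] ])) suffix-map ⟩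
  map red (factors (suc m) (map (c b) w) ++ [ map (c b) (suffix m w) ++ [ b ] ])
    ≡⟨ map-++ red (factors (suc m) (map (c b) w)) _ ⟩
  map red (factors (suc m) (map (c b) w)) ++ [ red (map (c b) (suffix m w) ++ [ b ]) ]
    ≡⟨ cong (_++ [ red (map (c b) (suffix m w) ++ [ b ]) ]) (trans (cong (map red) (factors-map (suc m) (c b) w)) (trans (sym (map-∘ (factors (suc m) w)))
         (map-cong (red-map (c-orderPreserving b)) (factors (suc m) w)))) ⟩
  patterns m w ++ [ red (map (c b) (suffix m w) ++ [ b ]) ] ∎
  where
  open ≡-Reasoning
  suffix-map : suffix m (map (c b) w) ≡ map (c b) (suffix m w)
  suffix-map = trans (cong (λ l → drop (l ∸ m) (map (c b) w)) (length-map (c b) w)) (drop-map (length w ∸ m) w)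

patternBound : ℕ → ℕ
patternBound m = length (wordsBelow (suc (suc m)) (suc m))

length-patterns≤ : ∀ m w → m ≤ length w → Unique (patterns m w) → length (patterns m w) ≤ patternBound m
length-patterns≤ m w m≤ patterns! = Unique-⊆⇒length≤ patterns! pattern∈wordsBelow
  where
  pattern∈wordsBelow : ∀ {e} → e ∈ patterns m w → e ∈ wordsBelow (suc (suc m)) (suc m)
  pattern∈wordsBelow e∈ with ∈-patterns⁻ m w e∈
  ... | j , j< , refl = subst (red (window m w j) ∈_) (cong (wordsBelow _) length≡)
      (∈-wordsBelow _ _ (subst (λ l → All (_< suc l) (red (window m w j))) length-window (red-bounded (window m w j))))
    where
    length-window : length (window m w j) ≡ suc m
    length-window = trans (length-take (suc m) (drop j w)) (m≤n⇒m⊓n≡m (m<length-drop m j w (window-bound m w m≤ j<)))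
    length≡ : length (red (window m w j)) ≡ suc m
    length≡ = trans (length-map _ (window m w j)) length-window

-- The greedy algorithm

extension-suc : ∀ π → Unique π → ∀ j → j ≤ length π →
  ∃ λ b → extension (suc j) π ≡ just (map (c b) π ++ [ b ]) × countLess b π ≡ j
extension-suc π π! j j≤ with suc j ≡ᵇ suc (length π) in top
... | true = B , cong (λ l → just (l ++ [ B ])) (sym map-c-B) ,
  trans (countLess-all< B π below) (sym (suc-injective (≡ᵇ⇒≡ (suc j) (suc (length π)) (subst T (sym top) _))))
  where
  B = suc (maxList π)
  below : All (_< B) π
  below = All.tabulate (λ x∈ → s≤s (maxList-upper π x∈))
  map-c-B : map (c B) π ≡ π
  map-c-B = trans (map-cong-local (All.map (c-below B) below)) (map-id π)
... | false with ithSmallest (suc j) π in found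
...   | just b  = b , refl , ≡ᵇ⇒≡ _ _ (findᵇ-sound _ π found)
...   | nothing with rank-surjective π π! j j<
  where
  j< : j < length π
  j< with m≤n⇒m<n∨m≡n j≤
  ... | inj₁ lt = lt
  ... | inj₂ e  = ⊥-elim (subst T top (≡⇒≡ᵇ (suc j) (suc (length π)) (cong suc e)))
...     | x , x∈ , rank≡j = ⊥-elim (findᵇ-complete _ π x∈ (≡⇒≡ᵇ _ j rank≡j) found)

any-red≡true⇒∈ : ∀ t F → any (λ f → eqList (red f) t) F ≡ true → t ∈ map red F
any-red≡true⇒∈ t (f ∷ F) e with ≡-dec _≟_ (red f) t
... | yes r≡t = here (sym r≡t)
... | no _    = there (any-red≡true⇒∈ t F e)

any-red≡false⇒∉ : ∀ t F → any (λ f → eqList (red f) t) F ≡ false → t ∉ map red F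
any-red≡false⇒∉ t (f ∷ F) e t∈ with ≡-dec _≟_ (red f) t | t∈
... | no r≢t | here t≡r  = r≢t (sym t≡r)
... | no _   | there t∈F = any-red≡false⇒∉ t F e t∈F

newExt-just : ∀ n w π i {e} → extension i π ≡ just e → newExt n w π i ≡ not (any (λ f → eqList (red f) (red e)) (factors n w))
newExt-just n w π i eq with extension i π
newExt-just n w π i refl | just _ = refl

newExt≡false⇒∈ : ∀ m w π i {e} → extension i π ≡ just e → newExt (suc m) w π i ≡ false → red e ∈ patterns m w
newExt≡false⇒∈ m w π i eq old =
  any-red≡true⇒∈ _ (factors (suc m) w) (not-injective (trans (sym (newExt-just (suc m) w π i eq)) old))

newExt≡true⇒∉ : ∀ m w π i {e} → extension i π ≡ just e → newExt (suc m) w π i ≡ true → red e ∉ patterns m w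
newExt≡true⇒∉ m w π i eq new =
  any-red≡false⇒∉ _ (factors (suc m) w) (not-injective (trans (sym (newExt-just (suc m) w π i eq)) new))

record GreedyState (m : ℕ) (w : List ℕ) : Set where
  field
    w! : Unique w
    m≤length : m ≤ length w
    starts-increasing : red (take m w) ≡ oneTo m
    patterns! : Unique (patterns m w)
    greedy : GreedyClosed (patterns m w)

Stuck : ℕ → List ℕ → Set
Stuck m w = OutSaturated m (patterns m w) (red (suffix m w))

initial-state : ∀ m → GreedyState m (map suc (upTo m))
initial-state m = record
  { w! = Unique.map⁺ suc-injective (Unique.upTo⁺ m)
  ; m≤length = ≤-reflexive (sym length-w)
  ; starts-increasing = trans (cong red (trans (take-all m w (≤-reflexive length-w)) (map-upTo suc m)))
      (trans (red-increasing (oneTo m) (AllPairs.applyUpTo⁺₁ suc m (λ i<j _ → s≤s i<j))) (cong oneTo (length-oneTo m)))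
  ; patterns! = subst Unique (sym no-patterns) []
  ; greedy = λ e∈ → ⊥-elim (∉[] (subst (_ ∈_) no-patterns e∈))
  }
  where
  w = map suc (upTo m)
  length-w : length w ≡ m
  length-w = trans (length-map suc (upTo m)) (length-upTo m)
  no-patterns : patterns m w ≡ []
  no-patterns with patterns m w | length-patterns m w
  ... | [] | _ = refl
  ... | _ ∷ _ | e = ⊥-elim (1+n≢0 (trans e (trans (cong (_∸ m) length-w) (n∸n≡0 m))))

module _ {m w} (st : GreedyState m w) where
  open GreedyState st

  π = suffix m w

  extension-pattern : ∀ j → j ≤ m → ∃ λ b → extension (suc j) π ≡ just (map (c b) π ++ [ b ])
    × red (map (c b) π ++ [ b ]) ≡ extendʳ (red π) (suc j)
  extension-pattern j j≤ with extension-suc π (Unique.drop⁺ (length w ∸ m) w!) j (subst (j ≤_) (sym (length-suffix m w m≤length)) j≤)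
  ... | b , eq , rank = b , eq , trans (red-extension b π) (cong (extendʳ (red π) ∘ suc) rank)

  old-extension∈ : ∀ j → j ≤ m → newExt (suc m) w π (suc j) ≡ false → extendʳ (red π) (suc j) ∈ patterns m w
  old-extension∈ j j≤ old with extension-pattern j j≤
  ... | b , eq , red≡ = subst (_∈ patterns m w) red≡ (newExt≡false⇒∈ m w π (suc j) eq old)

  GreedyState-∷ʳ : ∀ b j → red (map (c b) π ++ [ b ]) ≡ extendʳ (red π) (suc j) →
    red (map (c b) π ++ [ b ]) ∉ patterns m w →
    (∀ i → 1 ≤ i → i < suc j → extendʳ (red π) i ∈ patterns m w) →
    GreedyState m (map (c b) w ++ [ b ])
  GreedyState-∷ʳ b j red≡ new∉ earlier = record
    { w! = Unique-∷ʳ⁺ (Unique.map⁺ (c-injective b) w!) (pivot∉map-c b w)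
    ; m≤length = ≤-trans m≤length (≤-trans (n≤1+n _) (≤-reflexive (sym (length-map-∷ʳ (c b) w b))))
    ; starts-increasing = trans (cong red (trans (take-++ˡ m (map (c b) w) [ b ] (subst (m ≤_) (sym (length-map (c b) w)) m≤length))
        (take-map m w))) (trans (red-map (c-orderPreserving b) (take m w)) starts-increasing)
    ; patterns! = subst Unique (sym patterns≡) (Unique-∷ʳ⁺ patterns! new∉)
    ; greedy = greedy′
    }
    where
    new = red (map (c b) π ++ [ b ])
    patterns≡ : patterns m (map (c b) w ++ [ b ]) ≡ patterns m w ++ [ new ]
    patterns≡ = patterns-∷ʳ m w b m≤length
    greedy′ : GreedyClosed (patterns m (map (c b) w ++ [ b ]))
    greedy′ {e} e∈ i 1≤i i< with ∈-++⁻ (patterns m w) (subst (e ∈_) patterns≡ e∈)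
    ... | inj₁ e∈old = subst (extendʳ (source e) i ∈_) (sym patterns≡) (∈-++⁺ˡ (greedy e∈old i 1≤i i<))
    ... | inj₂ (here refl) = subst (extendʳ (source e) i ∈_) (sym patterns≡) (∈-++⁺ˡ
      (subst (λ v → extendʳ v i ∈ patterns m w) (sym (trans (cong source red≡) (source-extendʳ (red π) (suc j))))
        (earlier i 1≤i (subst (i <_) (trans (cong lastOr0 red≡) (lastOr0-extendʳ (red π) (suc j))) i<))))

  step-spec : (step (suc m) w ≡ nothing × Stuck m w)
            ⊎ (∃ λ w′ → step (suc m) w ≡ just w′ × GreedyState m w′ × length w′ ≡ suc (length w))
  step-spec with findᵇ (newExt (suc m) w π) (applyUpTo suc (suc m)) in found
  ... | nothing = inj₁ (refl , stuck)
    where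
    stuck : Stuck m w
    stuck (suc j) _ (s≤s j≤) = old-extension∈ j j≤ (findᵇ-applyUpTo-nothing _ suc (suc m) found j (s≤s j≤))
  ... | just i with findᵇ-applyUpTo-just _ suc (suc m) found
  ...   | j , j< , refl , new , earlier-old with extension-pattern j (≤-pred j<)
  ...     | b , eq , red≡ with newExt≡true⇒∉ m w π (suc j) eq new
  ...       | new∉ rewrite eq | lastOr0-∷ʳ (map (c b) π) b =
    inj₂ (_ , refl , GreedyState-∷ʳ b j red≡ new∉ earlier , length-map-∷ʳ (c b) w b)
    where
    earlier : ∀ i → 1 ≤ i → i < suc j → extendʳ (red π) i ∈ patterns m w
    earlier (suc j′) _ (s≤s j′<j) = old-extension∈ j′ (≤-trans (<⇒≤ j′<j) (≤-pred j<)) (earlier-old j′ j′<j)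

Halts : ℕ → Set
Halts m = ∃ λ k → ∃ λ w → Pi' (suc m) k ≡ just w × step (suc m) w ≡ nothing × GreedyState m w × Stuck m w

run : ∀ m k → Halts m ⊎ (∃ λ w → Pi' (suc m) k ≡ just w × GreedyState m w × length w ≡ k + m)
run m zero = inj₂ (_ , refl , initial-state m , trans (length-map suc (upTo m)) (length-upTo m))
run m (suc k) with run m k
... | inj₁ halts = inj₁ halts
... | inj₂ (w , Pi′≡ , st , length-w) with step-spec st
...   | inj₁ (halt , stuck) = inj₁ (k , w , Pi′≡ , halt , st , stuck)
...   | inj₂ (w′ , next , st′ , length-w′) rewrite Pi′≡ = inj₂ (w′ , next , st′ , trans length-w′ (cong suc length-w))

greedy-halts : ∀ m → Halts m
greedy-halts m with run m (suc (patternBound m))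
... | inj₁ halts = halts
... | inj₂ (w , _ , st , length-w) = ⊥-elim (<-irrefl refl (begin-strict
  patternBound m                    <⟨ n<1+n _ ⟩
  suc (patternBound m)              ≡⟨ m+n∸n≡m _ m ⟨
  suc (patternBound m) + m ∸ m      ≡⟨ cong (_∸ m) length-w ⟨
  length w ∸ m                      ≡⟨ length-patterns m w ⟨
  length (patterns m w)             ≤⟨ length-patterns≤ m w m≤length patterns! ⟩
  patternBound m                    ∎))
  where
  open ≤-Reasoning
  open GreedyState st

stuck⇒UWord : ∀ m w → GreedyState m w → Stuck m w → UWord (suc m) w
stuck⇒UWord m w st stuck p p↭ = begin
  occurrences (suc m) w p        ≡⟨ count-map p red (factors (suc m) w) ⟨
  count p (patterns m w)         ≡⟨ count-unique p (patterns m w) patterns! p∈ ⟩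
  1                              ∎
  where
  open ≡-Reasoning
  open GreedyState st
  open Patterns m w w! m≤length
  open Trail.SpanningTree m (patterns m w) (red (take m w)) (red (suffix m w))
    patterns! patterns-walk patterns-edge-shape greedy starts-increasing stuck
  p∈ : p ∈ patterns m w
  p∈ = subst (_∈ patterns m w) (red-permutation (suc m) p p↭)
    (red∈L p (Unique-resp-↭ (↭-sym p↭) (Unique.map⁺ suc-injective (Unique.upTo⁺ (suc m))))
      (trans (↭-length p↭) (trans (length-map suc (upTo (suc m))) (length-upTo (suc m)))))

theorem2p3 : (n : ℕ) → 2 ≤ n →
    Σ ℕ (λ k → Σ (List ℕ) (λ w →
      Pi' n k ≡ just w × step n w ≡ nothing × UWord n w))
theorem2p3 zero ()
theorem2p3 (suc m) _ with greedy-halts m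
... | k , w , Pi′≡w , halt , st , stuck = k , w , Pi′≡w , halt , stuck⇒UWord m w st stuck
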